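{- For any distinct primes $p$ and $q$, any positive integers $\alpha,\beta$ and any integer $k\geq 3$, the number $p^{\alpha}q^{\beta}$ is not a $k$-layered number.
   Context: For a positive integer $k$, a positive integer $n$ is $k$-layered if the set of its positive divisors can be partitioned into $k$ disjoint subsets all having the same sum. -}

module Defs where

open import Data.Nat using (ℕ; suc; _+_)
open import Data.Nat.Divisibility using (_∣?_)
open import Data.Fin using (Fin; _≟_)
open import Data.List using (List; filter; upTo; map)
open import Data.Nat.ListAction using (sum)
open import Data.Product using (Σ)
open import Relation.Binary.PropositionalEquality using (_≡_)

divisors : ℕ → List ℕ
divisors n = filter (_∣? n) (map suc (upTo n))

blockSum : ∀ {k} → ℕ → (ℕ → Fin k) → Fin k → ℕ
blockSum n c i = sum (filter (λ d → c d ≟ i) (divisors n))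

-- n is k-layered: the divisor set of n can be partitioned into k disjoint
-- subsets (blocks c⁻¹(i), i : Fin k, restricted to divisors) all with the same sum.
Layered : ℕ → ℕ → Set
Layered k n = Σ (ℕ → Fin k) λ c → ∀ i j → blockSum n c i ≡ blockSum n c j

-- The argument compares two estimates for σ(n), the sum of the divisors of n.
--  * Lower bound (holds for every n > 0): the block containing n has sum at
--    least n, all blocks have equal sums, and three distinct blocks are
--    disjoint parts of the divisor list, so 3·n ≤ σ(n).
--  * Upper bound: every divisor of p^α·q^β is of the form p^i·q^j with i ≤ α,
--    j ≤ β, and the divisor list has no repetitions, so σ(n) is at most the
--    product of the geometric sums (1 + … + p^α)(1 + … + q^β).  Multiplying by
--    (p-1)(q-1) gives σ(n)·(p-1)(q-1) < p·q·n, and for distinct primes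
--    p·q ≤ 3·(p-1)(q-1) (the extreme case being {2,3}), hence σ(n) < 3·n.
-- The argument never uses α, β ≥ 1: the bound σ(n) < 3·n holds for all α, β.
module Submission where

open import Defs
open import Data.Nat using (ℕ; _^_; _*_; _≤_)
open import Data.Nat.Primality using (Prime)
open import Relation.Binary.PropositionalEquality using (_≢_)
open import Relation.Nullary using (¬_)

open import Data.Nat using (zero; suc; _+_; _<_; z≤n; s≤s; nonTrivial⇒n>1)
open import Data.Nat.Properties hiding (_≟_)
open import Data.Nat.Divisibility using (_∣_; _∣?_; divides; ∣-refl; ∣1⇒≡1; *-cancelʳ-∣)
open import Data.Nat.Coprimality using (Coprime; coprime-divisor)
open import Data.Nat.Primality using (prime; prime⇒irreducible; prime⇒nonZero)
open import Data.Nat.ListAction using (sum)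
open import Data.Nat.ListAction.Properties using (sum-++)
open import Data.Nat.Tactic.RingSolver using (solve-∀)
open import Data.Fin using (Fin; _≟_) renaming (zero to fzero; suc to fsuc)
open import Data.List using (List; []; _∷_; _++_; filter; map; upTo; cartesianProductWith)
open import Data.List.Membership.Propositional using (_∈_)
open import Data.List.Membership.Propositional.Properties
  using (∈-map⁺; ∈-++⁺ˡ; ∈-++⁺ʳ; ∈-++⁻; ∈-∃++; ∈-filter⁺; ∈-filter⁻; ∈-upTo⁺;
         ∈-cartesianProductWith⁺)
open import Data.List.Relation.Unary.Any using (here; there)
open import Data.List.Relation.Unary.All using (lookup)
open import Data.List.Relation.Unary.Unique.Propositional using (Unique; _∷_)
import Data.List.Relation.Unary.Unique.Propositional.Properties as Unique
open import Data.Product using (Σ; _,_; _×_; proj₂)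
open import Data.Sum using (inj₁; inj₂)
open import Relation.Nullary using (yes; no; contradiction)
open import Relation.Binary.PropositionalEquality
  using (_≡_; refl; sym; trans; cong; cong₂; subst; module ≡-Reasoning)

module Blocks {k : ℕ} (c : ℕ → Fin k) where

  block : Fin k → List ℕ → ℕ
  block i L = sum (filter (λ d → c d ≟ i) L)

  member≤block : ∀ {x} i L → x ∈ L → c x ≡ i → x ≤ block i L
  member≤block i (y ∷ L) (here refl) cy≡i with c y ≟ i
  ... | yes _    = m≤m+n y (block i L)
  ... | no cy≢i  = contradiction cy≡i cy≢i
  member≤block i (y ∷ L) (there x∈L) cx≡i with c y ≟ i
  ... | yes _ = ≤-trans (member≤block i L x∈L cx≡i) (m≤n+m (block i L) y)
  ... | no _  = member≤block i L x∈L cx≡i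

  -- where a new entry x lands in one of the three blocks, it is added to that
  -- block's sum; these identities move it to the front
  private
    enter₁ : ∀ x a b d → x + a + b + d ≡ x + (a + b + d)
    enter₁ = solve-∀
    enter₂ : ∀ x a b d → a + (x + b) + d ≡ x + (a + b + d)
    enter₂ = solve-∀
    enter₃ : ∀ x a b d → a + b + (x + d) ≡ x + (a + b + d)
    enter₃ = solve-∀

  three-blocks≤sum : ∀ i j l → i ≢ j → i ≢ l → j ≢ l → ∀ L →
                     block i L + block j L + block l L ≤ sum L
  three-blocks≤sum i j l i≢j i≢l j≢l [] = z≤n
  three-blocks≤sum i j l i≢j i≢l j≢l (x ∷ L) with c x ≟ i | c x ≟ j | c x ≟ l
  ... | yes e₁ | yes e₂ | _      = contradiction (trans (sym e₁) e₂) i≢j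
  ... | yes e₁ | _      | yes e₃ = contradiction (trans (sym e₁) e₃) i≢l
  ... | _      | yes e₂ | yes e₃ = contradiction (trans (sym e₂) e₃) j≢l
  ... | yes _  | no _   | no _   =
    subst (_≤ x + sum L) (sym (enter₁ x (block i L) (block j L) (block l L)))
          (+-monoʳ-≤ x (three-blocks≤sum i j l i≢j i≢l j≢l L))
  ... | no _   | yes _  | no _   =
    subst (_≤ x + sum L) (sym (enter₂ x (block i L) (block j L) (block l L)))
          (+-monoʳ-≤ x (three-blocks≤sum i j l i≢j i≢l j≢l L))
  ... | no _   | no _   | yes _  =
    subst (_≤ x + sum L) (sym (enter₃ x (block i L) (block j L) (block l L)))
          (+-monoʳ-≤ x (three-blocks≤sum i j l i≢j i≢l j≢l L))
  ... | no _   | no _   | no _   = ≤-trans (three-blocks≤sum i j l i≢j i≢l j≢l L) (m≤n+m (sum L) x)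

sum-mono-⊆ : ∀ L M → Unique L → (∀ {x} → x ∈ L → x ∈ M) → sum L ≤ sum M
sum-mono-⊆ []      M _           _   = z≤n
sum-mono-⊆ (x ∷ L) M (x∉L ∷ uL) L⊆M with ∈-∃++ (L⊆M (here refl))
... | ys , zs , refl =
  subst (x + sum L ≤_) x+rest≡sum (+-monoʳ-≤ x (sum-mono-⊆ L (ys ++ zs) uL L⊆rest))
  where
  L⊆rest : ∀ {y} → y ∈ L → y ∈ ys ++ zs
  L⊆rest y∈L with ∈-++⁻ ys (L⊆M (there y∈L))
  ... | inj₁ y∈ys          = ∈-++⁺ˡ y∈ys
  ... | inj₂ (here refl)   = contradiction refl (lookup x∉L y∈L)
  ... | inj₂ (there y∈zs)  = ∈-++⁺ʳ ys y∈zs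
  x+rest≡sum : x + sum (ys ++ zs) ≡ sum (ys ++ x ∷ zs)
  x+rest≡sum = begin
    x + sum (ys ++ zs)       ≡⟨ cong (x +_) (sum-++ ys zs) ⟩
    x + (sum ys + sum zs)    ≡⟨ +-assoc-comm x (sum ys) (sum zs) ⟩
    sum ys + (x + sum zs)    ≡⟨ sum-++ ys (x ∷ zs) ⟨
    sum (ys ++ x ∷ zs)       ∎
    where
    open ≡-Reasoning
    +-assoc-comm : ∀ x a b → x + (a + b) ≡ a + (x + b)
    +-assoc-comm = solve-∀

sum-map-* : ∀ u N → sum (map (u *_) N) ≡ u * sum N
sum-map-* u []      = sym (*-zeroʳ u)
sum-map-* u (v ∷ N) = trans (cong (u * v +_) (sum-map-* u N)) (sym (*-distribˡ-+ u v (sum N)))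

sum-products : ∀ U N → sum (cartesianProductWith _*_ U N) ≡ sum U * sum N
sum-products []      N = refl
sum-products (u ∷ U) N = begin
  sum (map (u *_) N ++ cartesianProductWith _*_ U N)        ≡⟨ sum-++ (map (u *_) N) _ ⟩
  sum (map (u *_) N) + sum (cartesianProductWith _*_ U N)   ≡⟨ cong₂ _+_ (sum-map-* u N) (sum-products U N) ⟩
  u * sum N + sum U * sum N                                 ≡⟨ *-distribʳ-+ (sum N) u (sum U) ⟨
  (u + sum U) * sum N                                       ∎
  where open ≡-Reasoning

powers : ℕ → ℕ → List ℕ
powers x zero    = 1 ∷ []
powers x (suc b) = x ^ suc b ∷ powers x b

powers-∋ : ∀ x {j} b → j ≤ b → x ^ j ∈ powers x b
powers-∋ x zero    z≤n = here refl
powers-∋ x (suc b) j≤1+b with m≤n⇒m<n∨m≡n j≤1+b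
... | inj₁ (s≤s j≤b) = there (powers-∋ x b j≤b)
... | inj₂ refl      = here refl

-- (x - 1)(1 + x + … + x^b) + 1 = x^(b+1), written with x = 1 + P
geometric-sum : ∀ P b → suc (sum (powers (suc P) b) * P) ≡ suc P ^ suc b
geometric-sum P zero = base P
  where
  base : ∀ P → suc ((1 + 0) * P) ≡ (1 + P) * 1
  base = solve-∀
geometric-sum P (suc b) = begin
  suc ((x ^ suc b + S) * P)         ≡⟨ split (x ^ suc b) S P ⟩
  x ^ suc b * P + suc (S * P)       ≡⟨ cong (x ^ suc b * P +_) (geometric-sum P b) ⟩
  x ^ suc b * P + x ^ suc b         ≡⟨ +-comm (x ^ suc b * P) (x ^ suc b) ⟩
  x ^ suc b + x ^ suc b * P         ≡⟨ *-suc (x ^ suc b) P ⟨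
  x ^ suc b * suc P                 ≡⟨ *-comm (x ^ suc b) x ⟩
  x ^ suc (suc b)                   ∎
  where
  open ≡-Reasoning
  x S : ℕ
  x = suc P
  S = sum (powers x b)
  split : ∀ y s P → suc ((y + s) * P) ≡ y * P + suc (s * P)
  split = solve-∀

geometric-product< : ∀ P Q α β →
  sum (powers (suc P) α) * sum (powers (suc Q) β) * (P * Q)
    < suc P * suc Q * (suc P ^ α * suc Q ^ β)
geometric-product< P Q α β = begin-strict
  Sp * Sq * (P * Q)               ≡⟨ regroup Sp Sq P Q ⟩
  (Sp * P) * (Sq * Q)             <⟨ *-mono-< (n<1+n (Sp * P)) (n<1+n (Sq * Q)) ⟩
  suc (Sp * P) * suc (Sq * Q)     ≡⟨ cong₂ _*_ (geometric-sum P α) (geometric-sum Q β) ⟩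
  suc P ^ suc α * suc Q ^ suc β   ≡⟨ regroup (suc P) (suc P ^ α) (suc Q) (suc Q ^ β) ⟩
  suc P * suc Q * (suc P ^ α * suc Q ^ β) ∎
  where
  open ≤-Reasoning
  Sp Sq : ℕ
  Sp = sum (powers (suc P) α)
  Sq = sum (powers (suc Q) β)
  regroup : ∀ a b c d → a * b * (c * d) ≡ (a * c) * (b * d)
  regroup = solve-∀

¬∣⇒coprime : ∀ {p d} → Prime p → ¬ (p ∣ d) → Coprime d p
¬∣⇒coprime pp p∤d (i∣d , i∣p) with prime⇒irreducible pp i∣p
... | inj₁ i≡1  = i≡1
... | inj₂ refl = contradiction i∣d p∤d

*-rotate : ∀ p x y → p * x * y ≡ x * y * p
*-rotate = solve-∀

divisor-shape : ∀ {p} → Prime p → ∀ a m d → d ∣ p ^ a * m →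
                Σ ℕ λ i → Σ ℕ λ e → i ≤ a × e ∣ m × d ≡ p ^ i * e
divisor-shape pp zero m d d∣m =
  0 , d , z≤n , subst (d ∣_) (*-identityˡ m) d∣m , sym (*-identityˡ d)
divisor-shape {p} pp (suc a) m d d∣n with p ∣? d
... | yes (divides d′ refl)
      with divisor-shape pp a m d′
             (*-cancelʳ-∣ p {{prime⇒nonZero pp}} (subst (d′ * p ∣_) (*-rotate p (p ^ a) m) d∣n))
...   | i , e , i≤a , e∣m , refl = suc i , e , s≤s i≤a , e∣m , sym (*-rotate p (p ^ i) e)
divisor-shape {p} pp (suc a) m d d∣n | no p∤d
  with divisor-shape pp a m d
         (coprime-divisor (¬∣⇒coprime pp p∤d) (subst (d ∣_) (*-assoc p (p ^ a) m) d∣n))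
... | i , e , i≤a , e∣m , d≡ = i , e , m≤n⇒m≤1+n i≤a , e∣m , d≡

n∈divisors : ∀ {n} → 0 < n → n ∈ divisors n
n∈divisors {suc m} _ = ∈-filter⁺ (_∣? suc m) (∈-map⁺ suc (∈-upTo⁺ (n<1+n m))) ∣-refl

divisors-unique : ∀ n → Unique (divisors n)
divisors-unique n =
  Unique.filter⁺ (_∣? n) {xs = map suc (upTo n)} (Unique.map⁺ suc-injective (Unique.upTo⁺ n))

layered⇒3n≤σ : ∀ k n → 3 ≤ k → 0 < n → Layered k n → 3 * n ≤ sum (divisors n)
layered⇒3n≤σ (suc (suc (suc k))) n (s≤s (s≤s (s≤s _))) n>0 (c , equal) = begin
  3 * n                                        ≡⟨ triple n ⟩
  n + n + n                                    ≤⟨ +-mono-≤ (+-mono-≤ (n≤block b₀) (n≤block b₁)) (n≤block b₂) ⟩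
  block b₀ ds + block b₁ ds + block b₂ ds      ≤⟨ three-blocks≤sum b₀ b₁ b₂ (λ ()) (λ ()) (λ ()) ds ⟩
  sum ds                                       ∎
  where
  open ≤-Reasoning
  open Blocks c
  ds : List ℕ
  ds = divisors n
  b₀ b₁ b₂ : Fin (suc (suc (suc k)))
  b₀ = fzero
  b₁ = fsuc fzero
  b₂ = fsuc (fsuc fzero)
  n≤block : ∀ i → n ≤ block i ds
  n≤block i = subst (n ≤_) (equal (c n) i) (member≤block (c n) ds (n∈divisors n>0) refl)
  triple : ∀ n → 3 * n ≡ n + n + n
  triple = solve-∀

divisors⊆products : ∀ {p q} → Prime p → Prime q → ∀ α β {d} →
  d ∈ divisors (p ^ α * q ^ β) → d ∈ cartesianProductWith _*_ (powers p α) (powers q β)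
divisors⊆products {p} {q} pp pq α β d∈ds
  with divisor-shape pp α (q ^ β) _ (proj₂ (∈-filter⁻ (_∣? _) {xs = map suc (upTo (p ^ α * q ^ β))} d∈ds))
... | i , e , i≤α , e∣qβ , refl
  with divisor-shape pq β 1 e (subst (e ∣_) (sym (*-identityʳ (q ^ β))) e∣qβ)
...   | j , f , j≤β , f∣1 , refl with ∣1⇒≡1 f∣1
...     | refl = subst (λ t → p ^ i * t ∈ cartesianProductWith _*_ (powers p α) (powers q β))
                   (sym (*-identityʳ (q ^ j)))
                   (∈-cartesianProductWith⁺ _*_ (powers-∋ p α i≤α) (powers-∋ q β j≤β))

σ≤geometric-product : ∀ {p q} → Prime p → Prime q → ∀ α β →
  sum (divisors (p ^ α * q ^ β)) ≤ sum (powers p α) * sum (powers q β)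
σ≤geometric-product {p} {q} pp pq α β =
  subst (sum (divisors (p ^ α * q ^ β)) ≤_) (sum-products (powers p α) (powers q β))
    (sum-mono-⊆ _ _ (divisors-unique (p ^ α * q ^ β)) (divisors⊆products pp pq α β))

prime⇒2+ : ∀ {p} → Prime p → Σ ℕ λ x → p ≡ 2 + x
prime⇒2+ {p} (prime {{nt}} _) with nonTrivial⇒n>1 p {{nt}}
... | s≤s (s≤s {n = x} _) = x , refl

distinct≥2⇒pq≤3[p-1][q-1] : ∀ x y → 2 + x ≢ 2 + y → (2 + x) * (2 + y) ≤ 3 * ((1 + x) * (1 + y))
distinct≥2⇒pq≤3[p-1][q-1] zero zero 2≢2 = contradiction refl 2≢2
distinct≥2⇒pq≤3[p-1][q-1] zero (suc y) _ =
  subst ((2 + 0) * (2 + suc y) ≤_) (sym (slack y)) (m≤m+n _ y)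
  where
  slack : ∀ y → 3 * ((1 + 0) * (1 + suc y)) ≡ (2 + 0) * (2 + suc y) + y
  slack = solve-∀
distinct≥2⇒pq≤3[p-1][q-1] (suc x) y _ =
  subst ((2 + suc x) * (2 + y) ≤_) (sym (slack x y)) (m≤m+n _ (3 * y + x + 2 * x * y))
  where
  slack : ∀ x y → 3 * ((1 + suc x) * (1 + y)) ≡ (2 + suc x) * (2 + y) + (3 * y + x + 2 * x * y)
  slack = solve-∀

σ<3n : ∀ {p q} → Prime p → Prime q → p ≢ q → ∀ α β →
       sum (divisors (p ^ α * q ^ β)) < 3 * (p ^ α * q ^ β)
σ<3n pp pq p≢q α β with prime⇒2+ pp | prime⇒2+ pq
... | x , refl | y , refl = *-cancelʳ-< PQ σ (3 * n) (begin-strict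
  σ * PQ                                               ≤⟨ *-monoˡ-≤ PQ (σ≤geometric-product pp pq α β) ⟩
  sum (powers (2 + x) α) * sum (powers (2 + y) β) * PQ <⟨ geometric-product< (suc x) (suc y) α β ⟩
  (2 + x) * (2 + y) * n                                ≤⟨ *-monoˡ-≤ n (distinct≥2⇒pq≤3[p-1][q-1] x y p≢q) ⟩
  3 * PQ * n                                           ≡⟨ swap PQ n ⟩
  3 * n * PQ                                           ∎)
  where
  open ≤-Reasoning
  PQ n σ : ℕ
  PQ = (1 + x) * (1 + y)
  n  = (2 + x) ^ α * (2 + y) ^ β
  σ  = sum (divisors n)
  swap : ∀ r n → 3 * r * n ≡ 3 * n * r
  swap = solve-∀

mainTheorem6 : ∀ (p q α β k : ℕ) → Prime p → Prime q → p ≢ q →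
               1 ≤ α → 1 ≤ β → 3 ≤ k →
               ¬ Layered k (p ^ α * q ^ β)
mainTheorem6 p q α β k pp pq p≢q _ _ 3≤k layered =
  <⇒≱ (σ<3n pp pq p≢q α β) (layered⇒3n≤σ k (p ^ α * q ^ β) 3≤k n>0 layered)
  where
  n>0 : 0 < p ^ α * q ^ β
  n>0 = *-mono-< (m^n>0 p {{prime⇒nonZero pp}} α) (m^n>0 q {{prime⇒nonZero pq}} β)
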